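{- Let $\mathbb{K}$ be a commutative ring, $N\ge1$, $m\ge1$, and let $F^{(1)},\ldots,F^{(m)}$ be $N$-tuples of formal power series in $N$ non-commuting indeterminates $X_1,\ldots,X_N$ with coefficients in $\mathbb{K}$ and with zero constant term, the $i$-th component being $F^{(l)}_i=\sum_{k\ge1}\sum_{\kappa\in[N]^k}F^{(l)}_{i,\kappa}X_\kappa$. Then for every $i\in[N]$, $k\ge1$ and $\kappa\in[N]^k$, the coefficient of $X_\kappa$ in the $i$-th component of the composition $F^{(1)}\circ\cdots\circ F^{(m)}$ is \[ \big(F^{(1)}\circ\cdots\circ F^{(m)}\big)_{i,\kappa}=\sum_{\overrightarrow{\mathcal{T}}\in\overrightarrow{\mathbb{F}}_{i,\kappa}(m)}\ \prod_{l=1}^m\prod_{v\in V_{l-1}}F^{(l)}_{\tau(v),\overrightarrow{\mu}(v)}. \]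
   Context: $[N]=\{1,\ldots,N\}$; for $\kappa=(\kappa_1,\ldots,\kappa_k)\in[N]^k$, $X_\kappa=X_{\kappa_1}\cdots X_{\kappa_k}$; variables do not commute with each other but commute with coefficients. Composition means substitution: $(F\circ G)_i=F_i(G_1,\ldots,G_N)$. A rooted planar tree is a finite rooted tree (root $v_0$, generation $V_k$ = vertices at distance $k$ from the root) in which the children of each vertex are linearly ordered (left to right); this induces a left-to-right order of the leaves. $\overrightarrow{\mathbb{F}}_{i,\kappa}(m)$ is the set of isomorphism classes (under order-preserving rooted tree isomorphisms preserving types) of pairs consisting of a rooted planar tree with exactly $k$ leaves, all lying in generation $m$, and a type function $\tau:V\to[N]$ with $\tau(v_0)=i$ and the $j$-th leaf from the left having type $\kappa_j$. For an internal vertex $v$ with children $w_1,\ldots,w_r$ in order, the free outdegree is $\overrightarrow{\mu}(v)=(\tau(w_1),\ldots,\tau(w_r))\in[N]^r$. -}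

module Defs where

open import Level using (Level; _⊔_)
open import Data.Nat using (ℕ; zero; suc)
open import Data.Fin using (Fin)
open import Data.List using (List; []; _∷_; _++_; map; concat; concatMap; length; allFin; tabulate; foldr)
open import Data.Product using (_×_; _,_; proj₁; proj₂)
open import Data.Empty using (⊥)
open import Data.Unit using (⊤)
open import Data.List.Membership.Propositional using (_∈_)
open import Data.List.Relation.Unary.Unique.Propositional using (Unique)
open import Function.Bundles using (_⇔_)
open import Relation.Binary.PropositionalEquality using (_≡_)
open import Relation.Nullary using (¬_)
open import Algebra.Bundles using (CommutativeRing)

-- Words over [N] = Fin N (non-commutative monomials X_κ)

Word : ℕ → Set
Word N = List (Fin N)

wordsOfLength : (N : ℕ) → ℕ → List (Word N)
wordsOfLength N zero    = [] ∷ []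
wordsOfLength N (suc r) = concatMap (λ a → map (a ∷_) (wordsOfLength N r)) (allFin N)

splits : ∀ {A : Set} → List A → List (List A × List A)
splits []       = ([] , []) ∷ []
splits (a ∷ as) = ([] , a ∷ as) ∷ map (λ p → (a ∷ proj₁ p , proj₂ p)) (splits as)

-- Formal power series over a commutative ring in N non-commuting
-- variables: a series is its coefficient function  κ ↦ F_κ ;
-- an N-tuple of series is  i ↦ κ ↦ F_{i,κ}.

module _ {c ℓ : Level} (R : CommutativeRing c ℓ) where
  open CommutativeRing R

  Series : ℕ → Set c
  Series N = Word N → Carrier

  Tuple : ℕ → Set c
  Tuple N = Fin N → Series N

  ZeroConstTerm : ∀ {N} → Tuple N → Set ℓ
  ZeroConstTerm F = ∀ i → F i [] ≈ 0#

  Σ-list : List Carrier → Carrier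
  Σ-list = foldr _+_ 0#

  Π-list : List Carrier → Carrier
  Π-list = foldr _*_ 1#

  prodCoeff : ∀ {N} → List (Series N) → Series N
  prodCoeff []       []      = 1#
  prodCoeff []       (_ ∷ _) = 0#
  prodCoeff (g ∷ gs) κ       =
    Σ-list (map (λ p → g (proj₁ p) * prodCoeff gs (proj₂ p)) (splits κ))

  -- Since G has zero constant term, only words ρ with |ρ| ≤ |κ| contribute
  -- to the coefficient of X_κ, so the sum is truncated there.
  _∘ₛ_ : ∀ {N} → Tuple N → Tuple N → Tuple N
  (F ∘ₛ G) i κ =
    Σ-list (concatMap
      (λ r → map (λ ρ → F i ρ * prodCoeff (map G ρ) κ) (wordsOfLength _ r))
      (Data.List.upTo (suc (length κ))))

  idTuple : ∀ {N} → Tuple N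
  idTuple i []           = 0#
  idTuple i (j ∷ [])     with Data.Fin._≟_ i j
  ... | Relation.Nullary.yes _ = 1#
  ... | Relation.Nullary.no  _ = 0#
  idTuple i (_ ∷ _ ∷ _)  = 0#

  composeAll : ∀ {N} → List (Tuple N) → Tuple N
  composeAll []       = idTuple
  composeAll (F ∷ Fs) = F ∘ₛ composeAll Fs

-- Rooted planar trees with types in [N]; each tree term is exactly an
-- isomorphism class (order-preserving, type-preserving) of typed
-- rooted planar trees.

data Tree (N : ℕ) : Set where
  node : Fin N → List (Tree N) → Tree N

module _ {N : ℕ} where

  τ : Tree N → Fin N
  τ (node a _) = a

  children : Tree N → List (Tree N)
  children (node _ cs) = cs

  μ : Tree N → Word N
  μ t = map τ (children t)

  -- vertices of generation k (as the subtrees rooted at them), left to right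
  mutual
    gen : ℕ → Tree N → List (Tree N)
    gen zero    t           = t ∷ []
    gen (suc k) (node _ cs) = genList k cs

    genList : ℕ → List (Tree N) → List (Tree N)
    genList k []       = []
    genList k (t ∷ ts) = gen k t ++ genList k ts

  mutual
    leafTypes : Tree N → Word N
    leafTypes (node a [])         = a ∷ []
    leafTypes (node a cs@(_ ∷ _)) = leafTypesList cs

    leafTypesList : List (Tree N) → Word N
    leafTypesList []       = []
    leafTypesList (t ∷ ts) = leafTypes t ++ leafTypesList ts

  mutual
    AllLeavesAt : ℕ → Tree N → Set
    AllLeavesAt zero    (node _ cs) = cs ≡ []
    AllLeavesAt (suc d) (node _ [])       = ⊥
    AllLeavesAt (suc d) (node _ (t ∷ ts)) = AllLeavesAt d t × AllLeavesAtList d ts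

    AllLeavesAtList : ℕ → List (Tree N) → Set
    AllLeavesAtList d []       = ⊤
    AllLeavesAtList d (t ∷ ts) = AllLeavesAt d t × AllLeavesAtList d ts

InF : (N : ℕ) → Fin N → Word N → ℕ → Tree N → Set
InF N i κ m t = (τ t ≡ i) × AllLeavesAt m t × (leafTypes t ≡ κ)

Enumerates : ∀ {A : Set} → List A → (A → Set) → Set
Enumerates L P = Unique L × (∀ t → (t ∈ L) ⇔ P t)

module _ {c ℓ : Level} (R : CommutativeRing c ℓ) where
  open CommutativeRing R

  weight : ∀ {N m} → (Fin m → Tuple R N) → Tree N → Carrier
  weight {m = m} Fs t =
    Π-list R (tabulate {n = m} (λ l →
      Π-list R (map (λ v → Fs l (τ v) (μ v)) (gen (Data.Fin.toℕ l) t))))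

-- With G = F⁽²⁾ ∘ ⋯ ∘ F⁽ᵐ⁾, the coefficient (F⁽¹⁾ ∘ G)_{i,κ} is
-- Σ_ρ F⁽¹⁾_{i,ρ} [X_κ](G_{ρ₁} ⋯ G_{ρ_r}). Expanding the product over the ways of cutting κ
-- into r consecutive pieces and inserting the induction hypothesis for each factor turns the
-- inner sum into a sum over forests of depth-(m−1) trees with root types ρ; grafting such a
-- forest onto a root of type i produces every tree of depth m exactly once, and its weight is
-- F⁽¹⁾_{i,ρ} times the weights of the subtrees for the shifted sequence F⁽²⁾, …, F⁽ᵐ⁾.
-- Zero constant terms kill ρ = [].

module Submission where

open import Defs
open import Data.Nat using (ℕ; zero; suc; _≤_; _<_; s≤s; z≤n)
open import Data.Nat.Properties using (≤-trans; +-mono-≤)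
open import Data.Fin using (Fin; _≟_; toℕ) renaming (zero to fzero; suc to fsuc)
open import Data.List using (List; []; _∷_; _++_; map; tabulate; concatMap; length; upTo; allFin)
open import Data.List.Properties
  using (map-++; map-∘; map-concatMap; length-map; length-++; ∷-injectiveˡ; ∷-injectiveʳ)
open import Data.List.Membership.Propositional using (_∈_; find; lose)
open import Data.List.Membership.Propositional.Properties
  using (∈-map⁺; ∈-map⁻; ∈-concatMap⁺; ∈-concatMap⁻; ∈-upTo⁺; ∈-allFin)
open import Data.List.Relation.Unary.Any using (here; there)
open import Data.List.Relation.Unary.All as All using ()
open import Data.List.Relation.Unary.AllPairs using ([]; _∷_)
open import Data.List.Relation.Unary.Unique.Propositional using (Unique)
open import Data.List.Relation.Unary.Unique.Propositional.Properties using (map⁺; ++⁺; upTo⁺; allFin⁺)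
open import Data.Product using (Σ; ∃; _×_; _,_; proj₁; proj₂)
open import Data.Unit using (tt)
open import Data.Empty using (⊥; ⊥-elim)
open import Relation.Nullary using (yes; no)
open import Relation.Binary.PropositionalEquality using (_≡_; _≢_; refl; sym; trans; cong; subst)
open import Function using (_∘_)
open import Function.Bundles using (mk⇔)
open import Algebra.Bundles using (CommutativeRing)

module _ {A B : Set} (f : A → List B) where

  ∈-concatMap⁺′ : ∀ {x xs y} → x ∈ xs → y ∈ f x → y ∈ concatMap f xs
  ∈-concatMap⁺′ x∈xs y∈fx = ∈-concatMap⁺ f (lose x∈xs y∈fx)

  ∈-concatMap⁻′ : ∀ xs {y} → y ∈ concatMap f xs → ∃ λ x → x ∈ xs × y ∈ f x
  ∈-concatMap⁻′ xs y∈ = find (∈-concatMap⁻ f {xs} y∈)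

  concatMap-unique : ∀ {xs} → Unique xs → (∀ x → Unique (f x)) →
                     (∀ {x x′ y} → y ∈ f x → y ∈ f x′ → x ≡ x′) → Unique (concatMap f xs)
  concatMap-unique []                 f! sep = []
  concatMap-unique {x ∷ xs} (x∉ ∷ xs!) f! sep = ++⁺ (f! x) (concatMap-unique xs! f! sep) disjoint
    where
    disjoint : ∀ {y} → y ∈ f x × y ∈ concatMap f xs → ⊥
    disjoint (y∈fx , y∈rest) with x′ , x′∈xs , y∈fx′ ← ∈-concatMap⁻′ xs y∈rest =
      All.lookup x∉ x′∈xs (sep y∈fx y∈fx′)

  concatMap-unique-by : ∀ {xs} → Unique xs → (∀ x → Unique (f x)) →
                        (key : B → A) → (∀ {x y} → y ∈ f x → key y ≡ x) → Unique (concatMap f xs)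
  concatMap-unique-by xs! f! key key-≡ =
    concatMap-unique xs! f! (λ y∈fx y∈fx′ → trans (sym (key-≡ y∈fx)) (key-≡ y∈fx′))

∈-map-∷⇒≡ : ∀ {A : Set} {x x′ : A} {xss yss : List (List A)} {ys : List A} →
            ys ∈ map (x ∷_) xss → ys ∈ map (x′ ∷_) yss → x ≡ x′
∈-map-∷⇒≡ {x = x} {x′} ys∈ ys∈′
  with _ , _ , refl ← ∈-map⁻ (x ∷_) ys∈
  with _ , _ , eq ← ∈-map⁻ (x′ ∷_) ys∈′ = ∷-injectiveˡ eq

module _ {A : Set} where

  ∈-splits⇒++ : ∀ (xs : List A) {p} → p ∈ splits xs → proj₁ p ++ proj₂ p ≡ xs
  ∈-splits⇒++ []       (here refl) = refl
  ∈-splits⇒++ (x ∷ xs) (here refl) = refl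
  ∈-splits⇒++ (x ∷ xs) (there p∈) with _ , p′∈ , refl ← ∈-map⁻ _ p∈ = cong (x ∷_) (∈-splits⇒++ xs p′∈)

  ∈-splits-++ : ∀ (us vs : List A) → (us , vs) ∈ splits (us ++ vs)
  ∈-splits-++ []       []      = here refl
  ∈-splits-++ []       (_ ∷ _) = here refl
  ∈-splits-++ (u ∷ us) vs      = there (∈-map⁺ _ (∈-splits-++ us vs))

  splits-unique : ∀ (xs : List A) → Unique (splits xs)
  splits-unique []       = All.[] ∷ []
  splits-unique (x ∷ xs) = All.tabulate first∉ ∷ map⁺ cons-injective (splits-unique xs)
    where
    cons-injective : ∀ {p q : List A × List A} → (x ∷ proj₁ p , proj₂ p) ≡ (x ∷ proj₁ q , proj₂ q) → p ≡ q
    cons-injective refl = refl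
    first∉ : ∀ {p} → p ∈ map (λ p → x ∷ proj₁ p , proj₂ p) (splits xs) → ([] , x ∷ xs) ≢ p
    first∉ p∈ eq with _ , _ , refl ← ∈-map⁻ _ p∈ with () ← eq

module _ {N : ℕ} where

  ∈-wordsOfLength⇒length : ∀ r {ρ : Word N} → ρ ∈ wordsOfLength N r → length ρ ≡ r
  ∈-wordsOfLength⇒length zero    (here refl) = refl
  ∈-wordsOfLength⇒length (suc r) ρ∈
    with a , _ , ρ∈′ ← ∈-concatMap⁻′ (λ b → map (b ∷_) (wordsOfLength N r)) (allFin N) ρ∈
    with _ , ρ′∈ , refl ← ∈-map⁻ (a ∷_) ρ∈′ =
    cong suc (∈-wordsOfLength⇒length r ρ′∈)

  ∈-wordsOfLength : ∀ (ρ : Word N) → ρ ∈ wordsOfLength N (length ρ)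
  ∈-wordsOfLength []      = here refl
  ∈-wordsOfLength (a ∷ ρ) =
    ∈-concatMap⁺′ (λ b → map (b ∷_) (wordsOfLength N (length ρ))) (∈-allFin a)
      (∈-map⁺ (a ∷_) (∈-wordsOfLength ρ))

  wordsOfLength-unique : ∀ r → Unique (wordsOfLength N r)
  wordsOfLength-unique zero    = All.[] ∷ []
  wordsOfLength-unique (suc r) =
    concatMap-unique _ (allFin⁺ N) (λ _ → map⁺ ∷-injectiveʳ (wordsOfLength-unique r)) ∈-map-∷⇒≡

  mutual
    1≤length-leafTypes : ∀ (t : Tree N) → 1 ≤ length (leafTypes t)
    1≤length-leafTypes (node a [])       = s≤s z≤n
    1≤length-leafTypes (node a (c ∷ cs)) = ≤-trans (s≤s z≤n) (length≤length-leafTypesList (c ∷ cs))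

    length≤length-leafTypesList : ∀ (cs : List (Tree N)) → length cs ≤ length (leafTypesList cs)
    length≤length-leafTypesList []       = z≤n
    length≤length-leafTypesList (c ∷ cs) =
      subst (suc (length cs) ≤_) (sym (length-++ (leafTypes c)))
        (+-mono-≤ (1≤length-leafTypes c) (length≤length-leafTypesList cs))

module Enumeration {N : ℕ} where

  Enumerator : Set
  Enumerator = Fin N → Word N → List (Tree N)

  Sound : ℕ → Enumerator → Set
  Sound d T = ∀ {i κ t} → t ∈ T i κ → InF N i κ d t

  Complete : ℕ → Enumerator → Set
  Complete d T = ∀ {i κ t} → InF N i κ d t → t ∈ T i κ

  InForest : ℕ → Word N → Word N → List (Tree N) → Set
  InForest d ρ κ cs = (map τ cs ≡ ρ) × AllLeavesAtList d cs × (leafTypesList cs ≡ κ)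

  leaves : Enumerator
  leaves i []          = []
  leaves i (j ∷ [])    with i ≟ j
  ... | yes _ = node i [] ∷ []
  ... | no  _ = []
  leaves i (_ ∷ _ ∷ _) = []

  mutual
    forests : Enumerator → Word N → Word N → List (List (Tree N))
    forests T []      []      = [] ∷ []
    forests T []      (_ ∷ _) = []
    forests T (j ∷ ρ) κ       = concatMap (consForests T j ρ) (splits κ)

    consForests : Enumerator → Fin N → Word N → Word N × Word N → List (List (Tree N))
    consForests T j ρ (u , v) = concatMap (λ t → map (t ∷_) (forests T ρ v)) (T j u)

  nodes : Enumerator → Fin N → Word N → Word N → List (Tree N)
  nodes T i κ []      = []
  nodes T i κ (j ∷ ρ) = map (node i) (forests T (j ∷ ρ) κ)

  nodesOfArity : Enumerator → Fin N → Word N → ℕ → List (Tree N)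
  nodesOfArity T i κ r = concatMap (nodes T i κ) (wordsOfLength N r)

  -- Arities above |κ| cannot occur because every child carries a leaf; this matches the
  -- truncation in the definition of _∘ₛ_.
  trees : ℕ → Enumerator
  trees zero        = leaves
  trees (suc d) i κ = concatMap (nodesOfArity (trees d) i κ) (upTo (suc (length κ)))

  leaves-sound : Sound 0 leaves
  leaves-sound {i} {j ∷ []} t∈ with i ≟ j
  leaves-sound {i} {j ∷ []} (here refl) | yes refl = refl , refl , refl
  leaves-sound {i} {_ ∷ _ ∷ _} ()

  leaves-complete : Complete 0 leaves
  leaves-complete {t = node i .[]} (refl , refl , refl) with i ≟ i
  ... | yes _ = here refl
  ... | no i≢i = ⊥-elim (i≢i refl)

  leaves-unique : ∀ i κ → Unique (leaves i κ)
  leaves-unique i []          = []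
  leaves-unique i (j ∷ [])    with i ≟ j
  ... | yes _ = All.[] ∷ []
  ... | no  _ = []
  leaves-unique i (_ ∷ _ ∷ _) = []

  ∈-consForests⁻ : ∀ {T j ρ u v cs} → cs ∈ consForests T j ρ (u , v) →
                   ∃ λ t → ∃ λ ts → cs ≡ t ∷ ts × t ∈ T j u × ts ∈ forests T ρ v
  ∈-consForests⁻ {T} {j} {ρ} {u} {v} cs∈
    with t , t∈ , cs∈′ ← ∈-concatMap⁻′ (λ t → map (t ∷_) (forests T ρ v)) (T j u) cs∈
    with ts , ts∈ , refl ← ∈-map⁻ (t ∷_) cs∈′ = t , ts , refl , t∈ , ts∈

  module Forests (T : Enumerator) (d : ℕ) (sound : Sound d T) where

    forests-sound : ∀ ρ κ {cs} → cs ∈ forests T ρ κ → InForest d ρ κ cs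
    forests-sound []      []  (here refl) = refl , tt , refl
    forests-sound (j ∷ ρ) κ   cs∈
      with (u , v) , uv∈ , cs∈′ ← ∈-concatMap⁻′ (consForests T j ρ) (splits κ) cs∈
      with t , ts , refl , t∈ , ts∈ ← ∈-consForests⁻ {T} {j} {ρ} {u} {v} cs∈′
      with refl , t-leaves , refl ← sound {j} {u} t∈
      with refl , ts-leaves , refl ← forests-sound ρ v ts∈ =
      refl , (t-leaves , ts-leaves) , ∈-splits⇒++ κ uv∈

    forests-complete : Complete d T → ∀ cs → AllLeavesAtList d cs →
                       cs ∈ forests T (map τ cs) (leafTypesList cs)
    forests-complete complete []       _                         = here refl
    forests-complete complete (c ∷ cs) (c-leaves , cs-leaves) =
      ∈-concatMap⁺′ (consForests T (τ c) (map τ cs)) (∈-splits-++ (leafTypes c) (leafTypesList cs))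
        (∈-concatMap⁺′ (λ t → map (t ∷_) (forests T (map τ cs) (leafTypesList cs)))
          (complete (refl , c-leaves , refl)) (∈-map⁺ (c ∷_) (forests-complete complete cs cs-leaves)))

    firstSplit : List (Tree N) → Word N × Word N
    firstSplit []       = [] , []
    firstSplit (t ∷ ts) = leafTypes t , leafTypesList ts

    ∈-consForests⇒firstSplit : ∀ {j ρ p cs} → cs ∈ consForests T j ρ p → firstSplit cs ≡ p
    ∈-consForests⇒firstSplit {j} {ρ} {u , v} cs∈
      with t , ts , refl , t∈ , ts∈ ← ∈-consForests⁻ {T} {j} {ρ} {u} {v} cs∈
      with _ , _ , refl ← sound {j} {u} t∈
      with _ , _ , refl ← forests-sound ρ v ts∈ = refl

    forests-unique : (∀ j u → Unique (T j u)) → ∀ ρ κ → Unique (forests T ρ κ)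
    forests-unique T! []      []      = All.[] ∷ []
    forests-unique T! []      (_ ∷ _) = []
    forests-unique T! (j ∷ ρ) κ       =
      concatMap-unique-by (consForests T j ρ) (splits-unique κ) consForests-unique
        firstSplit (∈-consForests⇒firstSplit {j} {ρ})
      where
      consForests-unique : ∀ p → Unique (consForests T j ρ p)
      consForests-unique (u , v) =
        concatMap-unique (λ t → map (t ∷_) (forests T ρ v)) (T! j u)
          (λ _ → map⁺ ∷-injectiveʳ (forests-unique T! ρ v)) ∈-map-∷⇒≡

    ∈-nodes⁻ : ∀ {i} κ ρ {t} → t ∈ nodes T i κ ρ → μ t ≡ ρ × InF N i κ (suc d) t
    ∈-nodes⁻ {i} κ (j ∷ ρ) t∈
      with cs , cs∈ , refl ← ∈-map⁻ (node i) t∈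
      with types , leaves-at , refl ← forests-sound (j ∷ ρ) κ cs∈ =
      types , node∈F cs types leaves-at
      where
      node∈F : ∀ cs → map τ cs ≡ j ∷ ρ → AllLeavesAtList d cs →
               InF N i (leafTypesList cs) (suc d) (node i cs)
      node∈F (_ ∷ _) _ leaves-at = refl , leaves-at , refl

    nodes-unique : (∀ j u → Unique (T j u)) → ∀ i κ ρ → Unique (nodes T i κ ρ)
    nodes-unique T! i κ []      = []
    nodes-unique T! i κ (j ∷ ρ) = map⁺ (λ { refl → refl }) (forests-unique T! (j ∷ ρ) κ)

  trees-sound : ∀ d → Sound d (trees d)
  trees-sound zero    = leaves-sound
  trees-sound (suc d) {i} {κ} t∈ =
    let r , _ , t∈′ = ∈-concatMap⁻′ (nodesOfArity (trees d) i κ) (upTo (suc (length κ))) t∈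
        ρ , _ , t∈″ = ∈-concatMap⁻′ (nodes (trees d) i κ) (wordsOfLength N r) t∈′
    in proj₂ (∈-nodes⁻ κ ρ t∈″)
    where open Forests (trees d) d (trees-sound d)

  trees-complete : ∀ d → Complete d (trees d)
  trees-complete zero = leaves-complete
  trees-complete (suc d) {t = node i (c ∷ cs)} (refl , cs-leaves , refl) =
    ∈-concatMap⁺′ (nodesOfArity (trees d) i κ) (∈-upTo⁺ arity<)
      (∈-concatMap⁺′ (nodes (trees d) i κ) (∈-wordsOfLength (map τ (c ∷ cs)))
        (∈-map⁺ (node i) (forests-complete (trees-complete d) (c ∷ cs) cs-leaves)))
    where
    open Forests (trees d) d (trees-sound d)
    κ = leafTypesList (c ∷ cs)
    arity< : length (map τ (c ∷ cs)) < suc (length κ)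
    arity< = s≤s (subst (_≤ length κ) (sym (length-map τ (c ∷ cs))) (length≤length-leafTypesList (c ∷ cs)))

  trees-unique : ∀ d i κ → Unique (trees d i κ)
  trees-unique zero    = leaves-unique
  trees-unique (suc d) i κ =
    concatMap-unique-by (nodesOfArity (trees d) i κ) (upTo⁺ (suc (length κ)))
      (λ r → concatMap-unique-by (nodes (trees d) i κ) (wordsOfLength-unique r)
               (nodes-unique (trees-unique d) i κ) μ (λ {ρ} t∈ → proj₁ (∈-nodes⁻ κ ρ t∈)))
      (length ∘ μ) ∈-nodesOfArity⇒arity
    where
    open Forests (trees d) d (trees-sound d)
    ∈-nodesOfArity⇒arity : ∀ {r t} → t ∈ nodesOfArity (trees d) i κ r → length (μ t) ≡ r
    ∈-nodesOfArity⇒arity {r} t∈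
      with ρ , ρ∈ , t∈′ ← ∈-concatMap⁻′ (nodes (trees d) i κ) (wordsOfLength N r) t∈
      with refl , _ ← ∈-nodes⁻ κ ρ t∈′ = ∈-wordsOfLength⇒length r ρ∈

  trees-enumerates : ∀ d i κ → Enumerates (trees d i κ) (InF N i κ d)
  trees-enumerates d i κ = trees-unique d i κ , λ t → mk⇔ (trees-sound d) (trees-complete d)

module Expansion {c ℓ} (R : CommutativeRing c ℓ) {N : ℕ} where
  open CommutativeRing R renaming (refl to ≈-refl; sym to ≈-sym; trans to ≈-trans)
  open import Relation.Binary.Reasoning.Setoid setoid
  open import Algebra.Properties.CommutativeSemigroup *-commutativeSemigroup using (interchange)
  open Enumeration {N}

  ∑ ∏ : List Carrier → Carrier
  ∑ = Σ-list R
  ∏ = Π-list R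

  ∑-++ : ∀ xs ys → ∑ (xs ++ ys) ≈ ∑ xs + ∑ ys
  ∑-++ []       ys = ≈-sym (+-identityˡ _)
  ∑-++ (x ∷ xs) ys = ≈-trans (+-congˡ (∑-++ xs ys)) (≈-sym (+-assoc _ _ _))

  ∏-++ : ∀ xs ys → ∏ (xs ++ ys) ≈ ∏ xs * ∏ ys
  ∏-++ []       ys = ≈-sym (*-identityˡ _)
  ∏-++ (x ∷ xs) ys = ≈-trans (*-congˡ (∏-++ xs ys)) (≈-sym (*-assoc _ _ _))

  ∑-concatMap : ∀ {A : Set} (g : A → List Carrier) xs → ∑ (concatMap g xs) ≈ ∑ (map (∑ ∘ g) xs)
  ∑-concatMap g []       = ≈-refl
  ∑-concatMap g (x ∷ xs) = ≈-trans (∑-++ (g x) _) (+-congˡ (∑-concatMap g xs))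

  ∑-map-concatMap : ∀ {A B : Set} (f : B → Carrier) (g : A → List B) xs →
                    ∑ (map f (concatMap g xs)) ≈ ∑ (map (λ x → ∑ (map f (g x))) xs)
  ∑-map-concatMap f g xs =
    ≈-trans (reflexive (cong ∑ (map-concatMap f g xs))) (∑-concatMap (map f ∘ g) xs)

  ∑-map-∘ : ∀ {A B : Set} (f : B → Carrier) (g : A → B) xs → ∑ (map f (map g xs)) ≈ ∑ (map (f ∘ g) xs)
  ∑-map-∘ f g xs = reflexive (cong ∑ (sym (map-∘ xs)))

  ∑-map-cong : ∀ {A : Set} {f g : A → Carrier} xs → (∀ {x} → x ∈ xs → f x ≈ g x) →
               ∑ (map f xs) ≈ ∑ (map g xs)
  ∑-map-cong []       f≈g = ≈-refl
  ∑-map-cong (x ∷ xs) f≈g = +-cong (f≈g (here refl)) (∑-map-cong xs (f≈g ∘ there))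

  *-distribˡ-∑ : ∀ {A : Set} a (f : A → Carrier) xs → a * ∑ (map f xs) ≈ ∑ (map (λ x → a * f x) xs)
  *-distribˡ-∑ a f []       = zeroʳ a
  *-distribˡ-∑ a f (x ∷ xs) = ≈-trans (distribˡ a _ _) (+-congˡ (*-distribˡ-∑ a f xs))

  *-distribʳ-∑ : ∀ {A : Set} b (f : A → Carrier) xs → ∑ (map f xs) * b ≈ ∑ (map (λ x → f x * b) xs)
  *-distribʳ-∑ b f []       = zeroˡ b
  *-distribʳ-∑ b f (x ∷ xs) = ≈-trans (distribʳ b _ _) (+-congˡ (*-distribʳ-∑ b f xs))

  ∏-tabulate-cong : ∀ n {f g : Fin n → Carrier} → (∀ l → f l ≈ g l) → ∏ (tabulate f) ≈ ∏ (tabulate g)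
  ∏-tabulate-cong zero    f≈g = ≈-refl
  ∏-tabulate-cong (suc n) f≈g = *-cong (f≈g fzero) (∏-tabulate-cong n (f≈g ∘ fsuc))

  ∏-tabulate-* : ∀ n (f g : Fin n → Carrier) →
                 ∏ (tabulate (λ l → f l * g l)) ≈ ∏ (tabulate f) * ∏ (tabulate g)
  ∏-tabulate-* zero    f g = ≈-sym (*-identityˡ 1#)
  ∏-tabulate-* (suc n) f g =
    ≈-trans (*-congˡ (∏-tabulate-* n (f ∘ fsuc) (g ∘ fsuc))) (interchange _ _ _ _)

  ∏-tabulate-1 : ∀ n → ∏ (tabulate {n = n} (λ _ → 1#)) ≈ 1#
  ∏-tabulate-1 zero    = ≈-refl
  ∏-tabulate-1 (suc n) = ≈-trans (*-identityˡ _) (∏-tabulate-1 n)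

  generationProduct : ∀ {n} → (Fin n → Tree N → Carrier) → Tree N → Carrier
  generationProduct {n} h t = ∏ (tabulate {n = n} (λ l → ∏ (map (h l) (gen (toℕ l) t))))

  generationProduct-genList : ∀ n (h : Fin n → Tree N → Carrier) cs →
    ∏ (tabulate (λ l → ∏ (map (h l) (genList (toℕ l) cs)))) ≈ ∏ (map (generationProduct h) cs)
  generationProduct-genList n h []       = ∏-tabulate-1 n
  generationProduct-genList n h (c ∷ cs) = begin
    ∏ (tabulate (λ l → ∏ (map (h l) (gen (toℕ l) c ++ genList (toℕ l) cs))))
      ≈⟨ ∏-tabulate-cong n (λ l → ≈-trans (reflexive (cong ∏ (map-++ (h l) (gen (toℕ l) c) _)))
                                           (∏-++ (map (h l) (gen (toℕ l) c)) _)) ⟩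
    ∏ (tabulate (λ l → ∏ (map (h l) (gen (toℕ l) c)) * ∏ (map (h l) (genList (toℕ l) cs))))
      ≈⟨ ∏-tabulate-* n _ _ ⟩
    generationProduct h c * ∏ (tabulate (λ l → ∏ (map (h l) (genList (toℕ l) cs))))
      ≈⟨ *-congˡ (generationProduct-genList n h cs) ⟩
    generationProduct h c * ∏ (map (generationProduct h) cs) ∎

  weight-node : ∀ {m} (F : Fin (suc m) → Tuple R N) i cs →
                weight R F (node i cs) ≈ F fzero i (map τ cs) * ∏ (map (weight R (F ∘ fsuc)) cs)
  weight-node {m} F i cs =
    *-cong (*-identityʳ _) (generationProduct-genList m (λ l v → F (fsuc l) (τ v) (μ v)) cs)

  module _ (T : Enumerator) (w : Tree N → Carrier) (G : Tuple R N)
           (G≈∑T : ∀ j u → G j u ≈ ∑ (map w (T j u))) where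

    forestWeight : List (Tree N) → Carrier
    forestWeight cs = ∏ (map w cs)

    prodCoeff≈∑forests : ∀ ρ κ → prodCoeff R (map G ρ) κ ≈ ∑ (map forestWeight (forests T ρ κ))
    prodCoeff≈∑forests []      []      = ≈-sym (+-identityʳ 1#)
    prodCoeff≈∑forests []      (_ ∷ _) = ≈-refl
    prodCoeff≈∑forests (j ∷ ρ) κ       = begin
      ∑ (map (λ (u , v) → G j u * prodCoeff R (map G ρ) v) (splits κ))
        ≈⟨ ∑-map-cong (splits κ) (λ {p} _ → consForests-sum p) ⟩
      ∑ (map (λ p → ∑ (map forestWeight (consForests T j ρ p))) (splits κ))
        ≈⟨ ∑-map-concatMap forestWeight (consForests T j ρ) (splits κ) ⟨
      ∑ (map forestWeight (forests T (j ∷ ρ) κ)) ∎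
      where
      consForests-sum : ∀ p → G j (proj₁ p) * prodCoeff R (map G ρ) (proj₂ p) ≈
                              ∑ (map forestWeight (consForests T j ρ p))
      consForests-sum (u , v) = begin
        G j u * prodCoeff R (map G ρ) v
          ≈⟨ *-cong (G≈∑T j u) (prodCoeff≈∑forests ρ v) ⟩
        ∑ (map w (T j u)) * ∑ (map forestWeight (forests T ρ v))
          ≈⟨ *-distribʳ-∑ _ w (T j u) ⟩
        ∑ (map (λ t → w t * ∑ (map forestWeight (forests T ρ v))) (T j u))
          ≈⟨ ∑-map-cong (T j u) (λ {t} _ → ≈-trans (*-distribˡ-∑ (w t) forestWeight (forests T ρ v))
                                                    (≈-sym (∑-map-∘ forestWeight (t ∷_) (forests T ρ v)))) ⟩
        ∑ (map (λ t → ∑ (map forestWeight (map (t ∷_) (forests T ρ v)))) (T j u))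
          ≈⟨ ∑-map-concatMap forestWeight (λ t → map (t ∷_) (forests T ρ v)) (T j u) ⟨
        ∑ (map forestWeight (consForests T j ρ (u , v))) ∎

  composeAll≈∑trees : ∀ m (F : Fin m → Tuple R N) → (∀ l → ZeroConstTerm R (F l)) →
                      ∀ i κ → composeAll R (tabulate F) i κ ≈ ∑ (map (weight R F) (trees m i κ))
  composeAll≈∑trees zero    F F₀ i []          = ≈-refl
  composeAll≈∑trees zero    F F₀ i (j ∷ [])    with i ≟ j
  ... | yes _ = ≈-sym (+-identityʳ _)
  ... | no  _ = ≈-refl
  composeAll≈∑trees zero    F F₀ i (_ ∷ _ ∷ _) = ≈-refl
  composeAll≈∑trees (suc m) F F₀ i κ           = begin
    ∑ (concatMap (λ r → map term (wordsOfLength N r)) arities)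
      ≈⟨ ∑-concatMap (λ r → map term (wordsOfLength N r)) arities ⟩
    ∑ (map (λ r → ∑ (map term (wordsOfLength N r))) arities)
      ≈⟨ ∑-map-cong arities (λ {r} _ → arity-sum r) ⟩
    ∑ (map (λ r → ∑ (map w (nodesOfArity T i κ r))) arities)
      ≈⟨ ∑-map-concatMap w (nodesOfArity T i κ) arities ⟨
    ∑ (map w (trees (suc m) i κ)) ∎
    where
    arities = upTo (suc (length κ))
    T = trees m
    w = weight R F
    G = composeAll R (tabulate (F ∘ fsuc))
    term : Word N → Carrier
    term ρ = F fzero i ρ * prodCoeff R (map G ρ) κ
    open Enumeration.Forests T m (trees-sound m)

    term≈∑nodes : ∀ ρ → term ρ ≈ ∑ (map w (nodes T i κ ρ))
    term≈∑nodes []      = ≈-trans (*-congʳ (F₀ fzero i)) (zeroˡ _)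
    term≈∑nodes (j ∷ ρ) = begin
      F fzero i (j ∷ ρ) * prodCoeff R (map G (j ∷ ρ)) κ
        ≈⟨ *-congˡ (prodCoeff≈∑forests T (weight R (F ∘ fsuc)) G IH (j ∷ ρ) κ) ⟩
      F fzero i (j ∷ ρ) * ∑ (map (forestWeight T (weight R (F ∘ fsuc)) G IH) (forests T (j ∷ ρ) κ))
        ≈⟨ *-distribˡ-∑ _ _ (forests T (j ∷ ρ) κ) ⟩
      ∑ (map (λ cs → F fzero i (j ∷ ρ) * ∏ (map (weight R (F ∘ fsuc)) cs)) (forests T (j ∷ ρ) κ))
        ≈⟨ ∑-map-cong (forests T (j ∷ ρ) κ) (λ {cs} cs∈ → ≈-trans
             (*-congʳ (reflexive (cong (F fzero i) (sym (proj₁ (forests-sound (j ∷ ρ) κ cs∈))))))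
             (≈-sym (weight-node F i cs))) ⟩
      ∑ (map (w ∘ node i) (forests T (j ∷ ρ) κ))
        ≈⟨ ∑-map-∘ w (node i) (forests T (j ∷ ρ) κ) ⟨
      ∑ (map w (nodes T i κ (j ∷ ρ))) ∎
      where
      IH : ∀ j u → G j u ≈ ∑ (map (weight R (F ∘ fsuc)) (trees m j u))
      IH = composeAll≈∑trees m (F ∘ fsuc) (F₀ ∘ fsuc)

    arity-sum : ∀ r → ∑ (map term (wordsOfLength N r)) ≈ ∑ (map w (nodesOfArity T i κ r))
    arity-sum r = ≈-trans (∑-map-cong (wordsOfLength N r) (λ {ρ} _ → term≈∑nodes ρ))
                          (≈-sym (∑-map-concatMap w (nodes T i κ) (wordsOfLength N r)))

open Enumeration using (trees; trees-enumerates)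

theorem3p2 : ∀ {c ℓ} (R : CommutativeRing c ℓ) (N : ℕ) → 1 ≤ N → (m : ℕ) → 1 ≤ m →
    (F : Fin m → Tuple R N) → (∀ l → ZeroConstTerm R (F l)) →
    (i : Fin N) (κ : Word N) → κ ≢ [] →
    Σ (List (Tree N)) (λ L → Enumerates L (InF N i κ m) ×
      CommutativeRing._≈_ R (composeAll R (tabulate F) i κ)
        (Σ-list R (map (weight R F) L)))
theorem3p2 R N _ m _ F F₀ i κ _ =
  trees m i κ , trees-enumerates m i κ , Expansion.composeAll≈∑trees R m F F₀ i κ
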